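{- Let $\mathcal{F}$ be a finite union-closed family of sets with $\emptyset\notin\mathcal{F}$ and height number $H(\mathcal{F})\ge2$. Let $A\in\mathcal{F}$ lie in the $k$-th height of $\mathcal{F}$, where $k\neq H(\mathcal{F})$. Let $T(A)$ consist of $A$ together with all sets of the $(k+1)$-th height of $\mathcal{F}$ that are contained in $A$. Then $T(A)$ is a union-closed family with height number $H(T(A))=2$.
   Context: A union-closed family is a finite family $\mathcal{F}$ of finite sets closed under pairwise union. Height decomposition: $\pi_1$ is the set of inclusion-minimal members of $\mathcal{F}$; inductively, while $\mathcal{F}\setminus(\pi_1\cup\dots\cup\pi_{i-1})\neq\emptyset$, $\pi_i$ is the set of inclusion-minimal members of $\mathcal{F}\setminus(\pi_1\cup\dots\cup\pi_{i-1})$; the number of steps until $\mathcal{F}$ is exhausted is the height number $H(\mathcal{F})$ (the same definition applies to any union-closed family, in particular to $T(A)$). For $1\le j\le H(\mathcal{F})$, the $j$-th height of $\mathcal{F}$ is $\pi_{H(\mathcal{F})+1-j}$. -}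

module Defs where

open import Data.Nat using (ℕ; zero; suc; _+_; _∸_)
open import Data.Bool.Properties using () renaming (_≟_ to _≟ᵇ_)
open import Data.Fin.Subset using (Subset; _∪_; _⊆_; _⊂_)
open import Data.Fin.Subset.Properties using (_⊆?_; _⊂?_)
open import Data.Vec.Properties using (≡-dec)
open import Data.List using (List; []; _∷_; filter; length)
open import Data.List.Relation.Unary.Any using (any?)
open import Data.List.Membership.Propositional using (_∈_)
open import Relation.Nullary using (¬?)
open import Relation.Binary.PropositionalEquality using (_≡_)
open import Relation.Binary using (DecidableEquality)

Family : ℕ → Set
Family n = List (Subset n)

_≟ˢ_ : ∀ {n} → DecidableEquality (Subset n)
_≟ˢ_ = ≡-dec _≟ᵇ_

UnionClosed : ∀ {n} → Family n → Set
UnionClosed F = ∀ {X Y} → X ∈ F → Y ∈ F → (X ∪ Y) ∈ F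

minimals : ∀ {n} → Family n → Family n
minimals F = filter (λ X → ¬? (any? (λ Y → Y ⊂? X) F)) F

removeMin : ∀ {n} → Family n → Family n
removeMin F = filter (λ X → ¬? (any? (λ Y → Y ≟ˢ X) (minimals F))) F

-- F with π₁,…,π_i removed
stripped : ∀ {n} → ℕ → Family n → Family n
stripped zero    F = F
stripped (suc i) F = stripped i (removeMin F)

-- π i F  (1-based); π 0 F = [] by convention (never used)
π : ∀ {n} → ℕ → Family n → Family n
π zero    F = []
π (suc i) F = minimals (stripped i F)

-- number of removal steps until exhausted; fuel = length F suffices,
-- since each step removes at least one member of a nonempty family
heightAux : ∀ {n} → ℕ → Family n → ℕ
heightAux zero    F        = zero
heightAux (suc f) []       = zero
heightAux (suc f) (X ∷ F)  = suc (heightAux f (removeMin (X ∷ F)))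

H : ∀ {n} → Family n → ℕ
H F = heightAux (length F) F

height : ∀ {n} → ℕ → Family n → Family n
height j F = π (H F + 1 ∸ j) F

T : ∀ {n} → Family n → ℕ → Subset n → Family n
T F k A = A ∷ filter (λ X → X ⊆? A) (height (suc k) F)

-- For k < H(F) the (k+1)-th and k-th heights of F are the first two layers
-- π₁(G), π₂(G) of the family G left after stripping the lower layers, and G is an
-- up-set of F.  So A is a non-minimal member of G and every member of G strictly
-- below A is minimal in G.  The members L of the (k+1)-th height below A are then
-- a non-empty antichain of strict subsets of A, and the union of two of them lies
-- in G below A, hence is either minimal again (in L) or equal to A.  Thus
-- T(A) = {A} ∪ L is union-closed with layers L and {A}.
module Submission where

open import Defs
open import Data.Nat using (ℕ; _≤_; _≥_)
open import Data.Fin.Subset using (Subset; ⊥)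
open import Data.List.Membership.Propositional using (_∈_; _∉_)
open import Data.Product using (_×_)
open import Relation.Binary.PropositionalEquality using (_≡_; _≢_)

open import Data.Nat using (zero; suc; _+_; _∸_; _<_; s≤s)
open import Data.Nat.Properties using (+-comm; ≤∧≢⇒<)
open import Data.Fin.Subset using (_⊆_; _⊂_; _⊄_; _∪_)
open import Data.Fin.Subset.Properties
  using (_⊆?_; _⊂?_; _∈?_; ⊆-antisym; ⊆-trans; ⊂-irref; ⊂-asymmetric; p⊂q⇒p⊆q;
         p⊆p∪q; q⊆p∪q; x∈p∪q⁻; ∪-comm; ∪-idem)
open import Data.Fin.Subset.Induction using (⊂-wellFounded; Acc; acc)
open import Data.List using ([]; _∷_; filter; length)
open import Data.List.Relation.Unary.Any as Any using (Any; here; there; any?)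
import Data.List.Relation.Unary.All as All
open import Data.List.Properties using (filter-all; filter-none; filter-accept; filter-reject)
open import Data.List.Membership.Propositional using (find)
open import Data.List.Membership.Propositional.Properties using (∈-filter⁺; ∈-filter⁻; ∈-length)
open import Data.Product using (∃; _,_; proj₁; proj₂)
open import Data.Sum using ([_,_])
open import Data.Empty using (⊥-elim)
open import Function using (id)
open import Relation.Nullary using (¬_; ¬?; yes; no)
open import Relation.Binary.PropositionalEquality using (refl; sym; trans; cong; subst)

private
  variable
    n : ℕ
    p q r : Subset n

⊆∧⊄⇒≡ : p ⊆ q → p ⊄ q → p ≡ q
⊆∧⊄⇒≡ {p = p} {q = q} p⊆q p⊄q = ⊆-antisym p⊆q q⊆p
  where
  q⊆p : q ⊆ p
  q⊆p {x} x∈q with x ∈? p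
  ... | yes x∈p = x∈p
  ... | no  x∉p = ⊥-elim (p⊄q (p⊆q , x , x∈q , x∉p))

∪-lub : p ⊆ r → q ⊆ r → p ∪ q ⊆ r
∪-lub {p = p} {q = q} p⊆r q⊆r m = [ p⊆r , q⊆r ] (x∈p∪q⁻ p q m)

p⊆q⇒p∪q≡q : p ⊆ q → p ∪ q ≡ q
p⊆q⇒p∪q≡q {p = p} {q = q} p⊆q = ⊆-antisym (∪-lub p⊆q id) (q⊆p∪q p q)

p⊆q⇒q∪p≡q : p ⊆ q → q ∪ p ≡ q
p⊆q⇒q∪p≡q {p = p} {q = q} p⊆q = trans (∪-comm q p) (p⊆q⇒p∪q≡q p⊆q)

module _ {n : ℕ} where

  private
    variable
      X Y : Subset n
      G : Family n

  IsMinimalIn : Family n → Subset n → Set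
  IsMinimalIn G X = X ∈ G × (∀ {Y} → Y ∈ G → Y ⊄ X)

  ∈-minimals⁻ : X ∈ minimals G → IsMinimalIn G X
  ∈-minimals⁻ {G = G} m with ∈-filter⁻ (λ X → ¬? (any? (λ Y → Y ⊂? X) G)) {xs = G} m
  ... | X∈G , noneBelow = X∈G , λ Y∈G Y⊂X → noneBelow (Any.map (λ { refl → Y⊂X }) Y∈G)

  ∈-minimals⁺ : IsMinimalIn G X → X ∈ minimals G
  ∈-minimals⁺ {G = G} (X∈G , minimal) =
    ∈-filter⁺ (λ X → ¬? (any? (λ Y → Y ⊂? X) G)) X∈G
      λ below → let _ , Y∈G , Y⊂X = find below in minimal Y∈G Y⊂X

  ∈-removeMin⁻ : X ∈ removeMin G → X ∈ G × X ∉ minimals G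
  ∈-removeMin⁻ {G = G} m with ∈-filter⁻ (λ X → ¬? (any? (λ Y → Y ≟ˢ X) (minimals G))) {xs = G} m
  ... | X∈G , notMin = X∈G , λ X∈minG → notMin (Any.map sym X∈minG)

  ∈-removeMin⁺ : X ∈ G → X ∉ minimals G → X ∈ removeMin G
  ∈-removeMin⁺ {G = G} X∈G notMin =
    ∈-filter⁺ (λ X → ¬? (any? (λ Y → Y ≟ˢ X) (minimals G))) X∈G
      λ X∈minG → notMin (Any.map sym X∈minG)

  minimal-⊆ : ∀ {G : Family n} {X} → X ∈ G → ∃ λ Z → Z ∈ minimals G × Z ⊆ X
  minimal-⊆ {G} {X} = go X (⊂-wellFounded X)
    where
    go : ∀ X → Acc _⊂_ X → X ∈ G → ∃ λ Z → Z ∈ minimals G × Z ⊆ X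
    go X (acc rec) X∈G with any? (λ Y → Y ⊂? X) G
    ... | no  noneBelow =
      X , ∈-minimals⁺ (X∈G , λ Y∈G Y⊂X → noneBelow (Any.map (λ { refl → Y⊂X }) Y∈G)) , id
    ... | yes below with find below
    ... | Y , Y∈G , Y⊂X with go Y (rec Y⊂X) Y∈G
    ... | Z , Z∈minG , Z⊆Y = Z , Z∈minG , ⊆-trans Z⊆Y (p⊂q⇒p⊆q Y⊂X)

  stripped-suc : ∀ i (F : Family n) → stripped (suc i) F ≡ removeMin (stripped i F)
  stripped-suc zero    F = refl
  stripped-suc (suc i) F = stripped-suc i (removeMin F)

  record IsUpSetOf (F G : Family n) : Set where
    field
      members : X ∈ G → X ∈ F
      upward  : X ∈ G → Y ∈ F → X ⊆ Y → Y ∈ G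

  open IsUpSetOf

  removeMin-isUpSetOf : ∀ {F} → IsUpSetOf F G → IsUpSetOf F (removeMin G)
  removeMin-isUpSetOf {G = G} G↑ = record
    { members = λ X∈G′ → members G↑ (proj₁ (∈-removeMin⁻ X∈G′))
    ; upward  = upward′
    }
    where
    upward′ : ∀ {X Y} → X ∈ removeMin G → Y ∈ _ → X ⊆ Y → Y ∈ removeMin G
    upward′ {X} {Y} X∈G′ Y∈F X⊆Y with ∈-removeMin⁻ {G = G} X∈G′
    ... | X∈G , X∉minG = ∈-removeMin⁺ (upward G↑ X∈G Y∈F X⊆Y) Y∉minG
      where
      Y∉minG : Y ∉ minimals G
      Y∉minG Y∈minG with X ⊂? Y
      ... | yes X⊂Y = proj₂ (∈-minimals⁻ Y∈minG) X∈G X⊂Y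
      ... | no  X⊄Y = X∉minG (subst (_∈ minimals G) (sym (⊆∧⊄⇒≡ X⊆Y X⊄Y)) Y∈minG)

  stripped-isUpSetOf : ∀ i (F : Family n) → IsUpSetOf F (stripped i F)
  stripped-isUpSetOf zero    F = record { members = id ; upward = λ _ Y∈F _ → Y∈F }
  stripped-isUpSetOf (suc i) F =
    subst (IsUpSetOf F) (sym (stripped-suc i F)) (removeMin-isUpSetOf (stripped-isUpSetOf i F))

  Antichain : Family n → Set
  Antichain G = ∀ {X Y} → X ∈ G → Y ∈ G → Y ⊄ X

  [-]-antichain : (A : Subset n) → Antichain (A ∷ [])
  [-]-antichain A (here refl) (here refl) = ⊂-irref refl

  minimals-antichain : Antichain G → minimals G ≡ G
  minimals-antichain {G = G} anti =
    filter-all (λ X → ¬? (any? (λ Y → Y ⊂? X) G))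
      (All.tabulate λ X∈G below → let _ , Y∈G , Y⊂X = find below in anti X∈G Y∈G Y⊂X)

  removeMin-antichain : Antichain G → removeMin G ≡ []
  removeMin-antichain {G = G} anti =
    filter-none (λ X → ¬? (any? (λ Y → Y ≟ˢ X) (minimals G)))
      (All.tabulate λ X∈G notMin →
        notMin (Any.map sym (subst (_ ∈_) (sym (minimals-antichain anti)) X∈G)))

  heightAux-[] : ∀ f → heightAux {n} f [] ≡ 0
  heightAux-[] zero    = refl
  heightAux-[] (suc f) = refl

  heightAux-[-] : ∀ {f} (A : Subset n) → 0 < f → heightAux f (A ∷ []) ≡ 1
  heightAux-[-] {suc f} A _ =
    cong suc (trans (cong (heightAux f) (removeMin-antichain ([-]-antichain A))) (heightAux-[] f))

  module _ {A : Subset n} {L : Family n} (L⊂A : ∀ {X} → X ∈ L → X ⊂ A) (anti : Antichain L)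
           {Z : Subset n} (Z∈L : Z ∈ L) where

    minimals-apex : minimals (A ∷ L) ≡ L
    minimals-apex =
      trans (filter-reject P? λ A-minimal → A-minimal (there (Any.map (λ { refl → L⊂A Z∈L }) Z∈L)))
            (filter-all P? (All.tabulate λ X∈L → minimal X∈L))
      where
      P? = λ X → ¬? (any? (λ Y → Y ⊂? X) (A ∷ L))
      minimal : ∀ {X} → X ∈ L → ¬ Any (_⊂ X) (A ∷ L)
      minimal X∈L (here A⊂X) = ⊂-asymmetric (L⊂A X∈L) A⊂X
      minimal X∈L (there below) = let _ , Y∈L , Y⊂X = find below in anti X∈L Y∈L Y⊂X

    removeMin-apex : removeMin (A ∷ L) ≡ A ∷ []
    removeMin-apex =
      trans (filter-accept P? λ A∈minimals →
               let _ , Y∈L , Y≡A = find (subst (Any (_≡ A)) minimals-apex A∈minimals)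
               in ⊂-irref Y≡A (L⊂A Y∈L))
            (cong (A ∷_) (filter-none P? (All.tabulate λ X∈L notMin →
               notMin (subst (Any (_≡ _)) (sym minimals-apex) (Any.map sym X∈L)))))
      where
      P? = λ X → ¬? (any? (λ Y → Y ≟ˢ X) (minimals (A ∷ L)))

    H-apex : H (A ∷ L) ≡ 2
    H-apex = cong suc (trans (cong (heightAux (length L)) removeMin-apex) (heightAux-[-] A (∈-length Z∈L)))

  apex-unionClosed : ∀ {A : Subset n} {L : Family n} → (∀ {X} → X ∈ L → X ⊆ A) →
                     (∀ {X Y} → X ∈ L → Y ∈ L → X ∪ Y ∈ A ∷ L) → UnionClosed (A ∷ L)
  apex-unionClosed {A} L⊆A L-∪ (here refl) (here refl) = here (∪-idem A)
  apex-unionClosed L⊆A L-∪ (here refl) (there Y∈L) = here (p⊆q⇒q∪p≡q (L⊆A Y∈L))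
  apex-unionClosed L⊆A L-∪ (there X∈L) (here refl) = here (p⊆q⇒p∪q≡q (L⊆A X∈L))
  apex-unionClosed L⊆A L-∪ (there X∈L) (there Y∈L) = L-∪ X∈L Y∈L

  module _ {F G : Family n} (F-∪ : UnionClosed F) (G↑ : IsUpSetOf F G)
           {A : Subset n} (A∈π : A ∈ minimals (removeMin G)) where

    private
      L : Family n
      L = filter (_⊆? A) (minimals G)

      ∈L⁻ : X ∈ L → X ∈ minimals G × X ⊆ A
      ∈L⁻ = ∈-filter⁻ (_⊆? A) {xs = minimals G}

      ∈L⁺ : X ∈ minimals G → X ⊆ A → X ∈ L
      ∈L⁺ = ∈-filter⁺ (_⊆? A)

      A∈G′ : A ∈ removeMin G
      A∈G′ = proj₁ (∈-minimals⁻ {G = removeMin G} A∈π)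

      A∈G : A ∈ G
      A∈G = proj₁ (∈-removeMin⁻ {G = G} A∈G′)

      L⊂A : X ∈ L → X ⊂ A
      L⊂A {X} X∈L with ∈L⁻ X∈L | X ⊂? A
      ... | _ , _ | yes X⊂A = X⊂A
      ... | X∈minG , X⊆A | no X⊄A =
        ⊥-elim (proj₂ (∈-removeMin⁻ {G = G} A∈G′) (subst (_∈ minimals G) (⊆∧⊄⇒≡ X⊆A X⊄A) X∈minG))

      L-antichain : Antichain L
      L-antichain X∈L Y∈L =
        proj₂ (∈-minimals⁻ {G = G} (proj₁ (∈L⁻ X∈L))) (proj₁ (∈-minimals⁻ {G = G} (proj₁ (∈L⁻ Y∈L))))

      -- A is the only non-minimal member of G below A.
      L-∪ : X ∈ L → Y ∈ L → X ∪ Y ∈ A ∷ L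
      L-∪ {X} {Y} X∈L Y∈L with ∈L⁻ X∈L | ∈L⁻ Y∈L | any? ((X ∪ Y) ≟ˢ_) (minimals G)
      ... | _ , X⊆A | _ , Y⊆A | yes X∪Y∈minG = there (∈L⁺ X∪Y∈minG (∪-lub X⊆A Y⊆A))
      ... | X∈minG , X⊆A | Y∈minG , Y⊆A | no X∪Y∉minG =
        here (⊆∧⊄⇒≡ (∪-lub X⊆A Y⊆A) (proj₂ (∈-minimals⁻ {G = removeMin G} A∈π) (∈-removeMin⁺ X∪Y∈G X∪Y∉minG)))
        where
        X∈G = proj₁ (∈-minimals⁻ {G = G} X∈minG)
        X∪Y∈G = upward G↑ X∈G (F-∪ (members G↑ X∈G) (members G↑ (proj₁ (∈-minimals⁻ {G = G} Y∈minG))))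
                               (p⊆p∪q Y)

    apex-shape : UnionClosed (A ∷ L) × H (A ∷ L) ≡ 2
    apex-shape with minimal-⊆ {G = G} A∈G
    ... | Z , Z∈minG , Z⊆A =
      apex-unionClosed (λ X∈L → proj₂ (∈L⁻ X∈L)) L-∪ , H-apex L⊂A L-antichain (∈L⁺ Z∈minG Z⊆A)

height-offsets : ∀ {h k} → k < h → ∃ λ d → h + 1 ∸ k ≡ suc (suc d) × h + 1 ∸ suc k ≡ suc d
height-offsets {suc h} {zero}  _         = h , cong suc (+-comm h 1) , +-comm h 1
height-offsets {suc h} {suc k} (s≤s k<h) = height-offsets k<h

consecutive-heights : (F : Family n) {k : ℕ} → k < H F →
  ∃ λ G → IsUpSetOf F G × height k F ≡ minimals (removeMin G) × height (suc k) F ≡ minimals G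
consecutive-heights F k<H with height-offsets k<H
... | d , k-offset , k+1-offset =
  stripped d F ,
  stripped-isUpSetOf d F ,
  trans (cong (λ i → π i F) k-offset) (cong minimals (stripped-suc d F)) ,
  cong (λ i → π i F) k+1-offset

lemma3p2p1 : ∀ {n} (F : Family n) → UnionClosed F → ⊥ ∉ F → H F ≥ 2 →
    (k : ℕ) → 1 ≤ k → k ≤ H F → k ≢ H F →
    (A : Subset n) → A ∈ height k F →
    UnionClosed (T F k A) × H (T F k A) ≡ 2
lemma3p2p1 F F-∪ _ _ k _ k≤H k≢H A A∈height-k
  with consecutive-heights F (≤∧≢⇒< k≤H k≢H)
... | G , G↑ , height-k≡ , height-k+1≡ =
  subst (λ P → UnionClosed (A ∷ filter (_⊆? A) P) × H (A ∷ filter (_⊆? A) P) ≡ 2)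
        (sym height-k+1≡)
        (apex-shape F-∪ G↑ (subst (A ∈_) height-k≡ A∈height-k))
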